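{- Let $F$ be a formula of propositional calculus in the variables $a_1,\dots,a_n$, let $0\le l\le n-1$, $q=2^l$, and let $M_F^{(l)}=R_0(F)\vee R_1(F)\vee\dots\vee R_{q-1}(F)$. If $T_q(M_F^{(l)})=0$, then $T_k(F)=0$ for every $k\in\{q,q+1,\dots,2q-1\}$, i.e. none of the truth assignments $T_q,\dots,T_{2q-1}$ satisfies $F$.
   Context: Truth assignments $\{a_1,\dots,a_n\}\to\{0,1\}$ are enumerated as $T_0,\dots,T_{2^n-1}$ so that $j=\sum_{r=1}^n2^{r-1}T_j(a_r)$; $T_j(G)\in\{0,1\}$ is the value of a formula $G$ under $T_j$. For $s\in\{0,\dots,2^n-1\}$ with binary representation $s=\sum_{r=1}^n2^{r-1}s_r$, $R_s(F)$ denotes the formula obtained from $F$ by replacing each variable $a_r$ with $s_r=1$ by its negation $\sim a_r$ (and $\sim a_r$ by $a_r$). $\vee$ denotes logical OR. -}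

module Defs where

open import Data.Nat using (ℕ; zero; suc; _+_; _*_; _^_; _<_; _≤_)
open import Data.Nat.DivMod using (_/_; _%_)
open import Data.Fin using (Fin; toℕ)
open import Data.Bool using (Bool; true; false; not; _∧_; _∨_)

-- Formulas of propositional calculus in variables a_1..a_n (variable a_{r+1} is  var r , r : Fin n).
data Formula (n : ℕ) : Set where
  var  : Fin n → Formula n
  ⊤f   : Formula n
  ⊥f   : Formula n
  ~_   : Formula n → Formula n
  _∧f_ : Formula n → Formula n → Formula n
  _∨f_ : Formula n → Formula n → Formula n
  _⇒f_ : Formula n → Formula n → Formula n
  _⇔f_ : Formula n → Formula n → Formula n

bit : ℕ → ℕ → Bool
bit j zero    with j % 2
... | zero  = false
... | suc _ = true
bit j (suc r) = bit (j / 2) r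

-- value of a formula under the truth assignment T_j : T_j(a_{r+1}) = bit r of j
eval : ∀ {n} → ℕ → Formula n → Bool
eval j (var r)   = bit j (toℕ r)
eval j ⊤f        = true
eval j ⊥f        = false
eval j (~ f)     = not (eval j f)
eval j (f ∧f g)  = eval j f ∧ eval j g
eval j (f ∨f g)  = eval j f ∨ eval j g
eval j (f ⇒f g)  = not (eval j f) ∨ eval j g
eval j (f ⇔f g)  with eval j f | eval j g
... | true  | b = b
... | false | b = not b

R : ∀ {n} → ℕ → Formula n → Formula n
R s (var r) with bit s (toℕ r)
... | true  = ~ var r
... | false = var r
R s (~ var r) with bit s (toℕ r)
... | true  = var r
... | false = ~ var r
R s ⊤f       = ⊤f
R s ⊥f       = ⊥f
R s (~ f)    = ~ R s f
R s (f ∧f g) = R s f ∧f R s g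
R s (f ∨f g) = R s f ∨f R s g
R s (f ⇒f g) = R s f ⇒f R s g
R s (f ⇔f g) = R s f ⇔f R s g

bigOrR : ∀ {n} → ℕ → Formula n → Formula n
bigOrR zero          F = ⊥f
bigOrR (suc zero)    F = R 0 F
bigOrR (suc (suc m)) F = bigOrR (suc m) F ∨f R (suc m) F

M : ∀ {n} → ℕ → Formula n → Formula n
M l F = bigOrR (2 ^ l) F

module Submission where

-- Write k = q + s with q = 2^l and s < q.  Since s < 2^l, the
-- binary digits of q + s are those of s together with the digit l, so the assignment
-- T_{q+s} is T_q with exactly the variables selected by s flipped; hence
-- T_q(R_s(F)) = T_{q+s}(F).  Moreover s < q, so R_s(F) is one of the disjuncts of
-- M_F^{(l)}, and a false disjunction has false disjuncts: T_q(R_s(F)) = 0.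

open import Defs
open import Data.Nat using (ℕ; zero; suc; _+_; _*_; _^_; _<_; _≤_; _∸_; s≤s)
open import Data.Nat.Properties
  using (+-comm; *-comm; +-cancelˡ-<; m+[n∸m]≡n; m<1+n⇒m<n∨m≡n)
open import Data.Nat.DivMod using (_/_; _%_; [m+kn]%n≡m%n; m*n%n≡0; m*n/n≡m; +-distrib-/-∣ˡ; m<n*o⇒m/o<n)
open import Data.Nat.Divisibility using (divides-refl)
open import Data.Fin using (toℕ)
open import Data.Bool using (Bool; true; false; not; _∧_; _∨_; _xor_)
open import Data.Bool.Properties
  using (not-involutive; true-xor; xor-comm; xor-identityʳ; ∨-conicalˡ; ∨-conicalʳ)
open import Data.Sum using ([_,_]′)
open import Relation.Binary.PropositionalEquality
  using (_≡_; refl; sym; trans; cong; cong₂; subst; module ≡-Reasoning)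

FlipsTo : ℕ → ℕ → ℕ → Set
FlipsTo j s t = ∀ r → bit j r xor bit s r ≡ bit t r

xor-true : ∀ a → a xor true ≡ not a
xor-true a = trans (xor-comm a true) (true-xor a)

iffᵇ : Bool → Bool → Bool
iffᵇ true  b = b
iffᵇ false b = not b

eval-⇔ : ∀ {n} j (F G : Formula n) → eval j (F ⇔f G) ≡ iffᵇ (eval j F) (eval j G)
eval-⇔ j F G with eval j F
... | true  = refl
... | false = refl

eval-R : ∀ {n j s t} → FlipsTo j s t → (F : Formula n) → eval j (R s F) ≡ eval t F
eval-R {j = j} {s} h (var r) with bit s (toℕ r) | h (toℕ r)
... | true  | flip = trans (sym (xor-true (bit j (toℕ r)))) flip
... | false | flip = trans (sym (xor-identityʳ _)) flip
eval-R {j = j} {s} h (~ var r) with bit s (toℕ r) | h (toℕ r)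
... | true  | flip = trans (sym (not-involutive _))
  (cong not (trans (sym (xor-true (bit j (toℕ r)))) flip))
... | false | flip = cong not (trans (sym (xor-identityʳ _)) flip)
eval-R h ⊤f          = refl
eval-R h ⊥f          = refl
eval-R h (~ ⊤f)       = refl
eval-R h (~ ⊥f)       = refl
eval-R h (~ (~ F))    = cong not (eval-R h (~ F))
eval-R h (~ (F ∧f G)) = cong not (eval-R h (F ∧f G))
eval-R h (~ (F ∨f G)) = cong not (eval-R h (F ∨f G))
eval-R h (~ (F ⇒f G)) = cong not (eval-R h (F ⇒f G))
eval-R h (~ (F ⇔f G)) = cong not (eval-R h (F ⇔f G))
eval-R h (F ∧f G)     = cong₂ _∧_ (eval-R h F) (eval-R h G)
eval-R h (F ∨f G)     = cong₂ _∨_ (eval-R h F) (eval-R h G)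
eval-R h (F ⇒f G)     = cong₂ (λ a b → not a ∨ b) (eval-R h F) (eval-R h G)
eval-R {j = j} {s} {t} h (F ⇔f G) = begin
    eval j (R s F ⇔f R s G)               ≡⟨ eval-⇔ j (R s F) (R s G) ⟩
    iffᵇ (eval j (R s F)) (eval j (R s G)) ≡⟨ cong₂ iffᵇ (eval-R h F) (eval-R h G) ⟩
    iffᵇ (eval t F) (eval t G)             ≡⟨ sym (eval-⇔ t F G) ⟩
    eval t (F ⇔f G)                        ∎
  where open ≡-Reasoning

bit-0-cong : ∀ i j → i % 2 ≡ j % 2 → bit i 0 ≡ bit j 0
bit-0-cong i j p with i % 2 | j % 2 | p
... | a | .a | refl = refl

bit-of-0 : ∀ r → bit 0 r ≡ false
bit-of-0 zero    = refl
bit-of-0 (suc r) = bit-of-0 r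

parity-2q+ : ∀ q s → (2 * q + s) % 2 ≡ s % 2
parity-2q+ q s = begin
  (2 * q + s) % 2 ≡⟨ cong (_% 2) (+-comm (2 * q) s) ⟩
  (s + 2 * q) % 2 ≡⟨ cong (λ x → (s + x) % 2) (*-comm 2 q) ⟩
  (s + q * 2) % 2 ≡⟨ [m+kn]%n≡m%n s q 2 ⟩
  s % 2           ∎
  where open ≡-Reasoning

parity-2q : ∀ q → (2 * q) % 2 ≡ 0
parity-2q q = trans (cong (_% 2) (*-comm 2 q)) (m*n%n≡0 q 2)

halve-2q : ∀ q → (2 * q) / 2 ≡ q
halve-2q q = trans (cong (_/ 2) (*-comm 2 q)) (m*n/n≡m q 2)

halve-2q+ : ∀ q s → (2 * q + s) / 2 ≡ q + s / 2
halve-2q+ q s = begin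
  (2 * q + s) / 2 ≡⟨ cong (λ x → (x + s) / 2) (*-comm 2 q) ⟩
  (q * 2 + s) / 2 ≡⟨ +-distrib-/-∣ˡ s (divides-refl q) ⟩
  q * 2 / 2 + s / 2 ≡⟨ cong (_+ s / 2) (m*n/n≡m q 2) ⟩
  q + s / 2       ∎
  where open ≡-Reasoning

-- For s < 2^l, adding 2^l to s only sets digit l (no carry occurs): digitwise,
-- 2^l + s is 2^l xor s.  Induction on l, peeling off the lowest digit.
bit-2^l+s : ∀ l s → s < 2 ^ l → FlipsTo (2 ^ l) s (2 ^ l + s)
bit-2^l+s zero    zero    _ r rewrite bit-of-0 r = xor-identityʳ (bit 1 r)
bit-2^l+s zero    (suc s) (s≤s ())
bit-2^l+s (suc l) s       _ zero = begin
    bit (2 * q) 0 xor bit s 0     ≡⟨ cong (_xor bit s 0) (bit-0-cong (2 * q) 0 (parity-2q q)) ⟩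
    bit 0 0 xor bit s 0           ≡⟨ bit-0-cong s (2 * q + s) (sym (parity-2q+ q s)) ⟩
    bit (2 * q + s) 0             ∎
  where
  open ≡-Reasoning
  q = 2 ^ l
bit-2^l+s (suc l) s s<2q (suc r) = begin
    bit (2 * q / 2) r xor bit (s / 2) r ≡⟨ cong (λ x → bit x r xor bit (s / 2) r) (halve-2q q) ⟩
    bit q r xor bit (s / 2) r           ≡⟨ bit-2^l+s l (s / 2) (m<n*o⇒m/o<n (subst (s <_) (*-comm 2 q) s<2q)) r ⟩
    bit (q + s / 2) r                   ≡⟨ cong (λ x → bit x r) (sym (halve-2q+ q s)) ⟩
    bit ((2 * q + s) / 2) r             ∎
  where
  open ≡-Reasoning
  q = 2 ^ l

bigOrR-false : ∀ {n} j (F : Formula n) m → eval j (bigOrR m F) ≡ false →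
  ∀ s → s < m → eval j (R s F) ≡ false
bigOrR-false j F (suc zero) h zero _ = h
bigOrR-false j F (suc zero) h (suc s) (s≤s ())
bigOrR-false j F (suc (suc m)) h s s<m+2 =
  [ bigOrR-false j F (suc m) (∨-conicalˡ _ _ h) s
  , (λ s≡m+1 → subst (λ x → eval j (R x F) ≡ false) (sym s≡m+1) (∨-conicalʳ _ _ h))
  ]′ (m<1+n⇒m<n∨m≡n s<m+2)

mainTheorem9 : (n : ℕ) (F : Formula n) (l : ℕ) → suc l ≤ n →
    eval (2 ^ l) (M l F) ≡ false →
    (k : ℕ) → 2 ^ l ≤ k → k < 2 ^ l + 2 ^ l → eval k F ≡ false
mainTheorem9 n F l _ M-false k q≤k k<2q = begin
    eval k F        ≡⟨ cong (λ x → eval x F) (sym q+s≡k) ⟩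
    eval (q + s) F  ≡⟨ sym (eval-R (bit-2^l+s l s s<q) F) ⟩
    eval q (R s F)  ≡⟨ bigOrR-false q F q M-false s s<q ⟩
    false           ∎
  where
  open ≡-Reasoning
  q = 2 ^ l
  s = k ∸ q
  q+s≡k : q + s ≡ k
  q+s≡k = m+[n∸m]≡n q≤k
  s<q : s < q
  s<q = +-cancelˡ-< q s q (subst (_< q + q) (sym q+s≡k) k<2q)
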